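{- The class of equistable graphs is not closed under join: there exist equistable graphs $G_1,G_2$ whose join is not equistable.
   Context: A graph $G=(V,E)$ is equistable if there is $\varphi:V\to\mathbb{R}_+$ such that for all $S\subseteq V$, $S$ is a maximal stable set of $G$ iff $\sum_{v\in S}\varphi(v)=1$. The join of two vertex-disjoint graphs is obtained from their disjoint union by adding all edges between them.
   Formalization: The weights $\varphi$ in the definition of equistable take values in the nonnegative rationals instead of $\mathbb{R}_+$. -}

module Defs where

open import Data.Nat using (ℕ; zero; suc; _+_)
open import Data.Fin using (Fin; zero; suc; splitAt)
open import Data.Fin.Subset using (Subset; _∈_; _⊆_)
open import Data.Vec using (Vec; []; _∷_)
open import Data.Bool using (Bool; true; false; if_then_else_)
open import Data.Sum using (_⊎_; inj₁; inj₂)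
open import Data.Product using (Σ; _×_)
open import Data.Rational using (ℚ; 0ℚ; 1ℚ; _≤_) renaming (_+_ to _+ℚ_)
open import Function.Bundles using (_⇔_)
open import Relation.Binary.PropositionalEquality using (_≡_; refl)

record Graph : Set where
  field
    n      : ℕ
    adj    : Fin n → Fin n → Bool
    sym    : ∀ i j → adj i j ≡ adj j i
    irrefl : ∀ i → adj i i ≡ false
open Graph public

Stable : (G : Graph) → Subset (n G) → Set
Stable G S = ∀ i j → i ∈ S → j ∈ S → adj G i j ≡ false

MaximalStable : (G : Graph) → Subset (n G) → Set
MaximalStable G S = Stable G S × (∀ T → S ⊆ T → Stable G T → T ⊆ S)

weight : ∀ {m} → (Fin m → ℚ) → Subset m → ℚ
weight {zero}  φ []      = 0ℚ
weight {suc m} φ (b ∷ S) = (if b then φ zero else 0ℚ) +ℚ weight (λ i → φ (suc i)) S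

Equistable : Graph → Set
Equistable G =
  Σ (Fin (n G) → ℚ) λ φ →
    (∀ v → 0ℚ ≤ φ v) × (∀ S → MaximalStable G S ⇔ (weight φ S ≡ 1ℚ))

-- Join of two graphs: vertex set Fin (n₁ + n₂), first n₁ vertices from G₁.
module _ (G₁ G₂ : Graph) where
  adj⊎ : Fin (n G₁) ⊎ Fin (n G₂) → Fin (n G₁) ⊎ Fin (n G₂) → Bool
  adj⊎ (inj₁ a) (inj₁ b) = adj G₁ a b
  adj⊎ (inj₂ a) (inj₂ b) = adj G₂ a b
  adj⊎ (inj₁ _) (inj₂ _) = true
  adj⊎ (inj₂ _) (inj₁ _) = true

  sym⊎ : ∀ x y → adj⊎ x y ≡ adj⊎ y x
  sym⊎ (inj₁ a) (inj₁ b) = sym G₁ a b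
  sym⊎ (inj₂ a) (inj₂ b) = sym G₂ a b
  sym⊎ (inj₁ _) (inj₂ _) = refl
  sym⊎ (inj₂ _) (inj₁ _) = refl

  irrefl⊎ : ∀ x → adj⊎ x x ≡ false
  irrefl⊎ (inj₁ a) = irrefl G₁ a
  irrefl⊎ (inj₂ a) = irrefl G₂ a

  join : Graph
  join = record
    { n      = n G₁ + n G₂
    ; adj    = λ i j → adj⊎ (splitAt (n G₁) i) (splitAt (n G₁) j)
    ; sym    = λ i j → sym⊎ (splitAt (n G₁) i) (splitAt (n G₁) j)
    ; irrefl = λ i → irrefl⊎ (splitAt (n G₁) i)
    }

{-# OPTIONS --safe #-}
module Submission where

open import Defs hiding (sym)
open import Algebra.Bundles using (CommutativeMonoid)
import Algebra.Properties.CommutativeSemigroup as CommutativeSemigroupProperties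
import Algebra.Properties.Group as GroupProperties
import Algebra.Solver.CommutativeMonoid as CommutativeMonoidSolver
open import Data.Bool using (Bool; true; false; not; _∧_; _∨_; if_then_else_)
import Data.Bool.Properties as Boolₚ
open import Data.Fin using (Fin; zero; suc; splitAt; _↑ˡ_; _↑ʳ_)
open import Data.Fin.Properties using (all?; any?; splitAt-↑ˡ; splitAt-↑ʳ; splitAt⁻¹-↑ˡ; splitAt⁻¹-↑ʳ)
open import Data.Fin.Subset using (Subset; _∈_; _∉_; _⊆_; ⁅_⁆; _∪_; ⊥; Nonempty)
open import Data.Fin.Subset.Properties using (_∈?_; ∉⊥; x∈⁅x⁆; x∈⁅y⁆⇒x≡y; p⊆p∪q; q⊆p∪q; x∈p∪q⁻)
open import Data.Integer using (+_)
open import Data.Nat using (ℕ; zero; suc; _+_; _≡ᵇ_; _<ᵇ_)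
open import Data.Product using (Σ; ∃; _×_; _,_; proj₁)
open import Data.Rational using (ℚ; 0ℚ; 1ℚ; ½; _≤_; _/_) renaming (_+_ to _+ℚ_; _*_ to _*ℚ_)
import Data.Rational.Properties as ℚₚ
open import Data.Sum using (inj₁; inj₂)
open import Data.Vec using (Vec; []; _∷_; here; lookup; _++_; tabulate)
import Data.Vec as Vec
open import Data.Vec.Properties using (lookup-++ˡ; lookup-++ʳ; []=⇒lookup; lookup⇒[]=)
open import Data.Vec.Relation.Unary.All using (All; []; _∷_)
import Data.Vec.Relation.Unary.All as All
open import Function using (_∘_)
open import Function.Bundles using (_⇔_; mk⇔; Equivalence)
open import Relation.Nullary using (¬_; Dec; yes; no; contradiction)
open import Relation.Nullary.Decidable using (map′; _×-dec_; _→-dec_; ¬?; toWitness)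
open import Relation.Binary.PropositionalEquality using (_≡_; refl; sym; trans; cong; cong₂; subst; module ≡-Reasoning)

open CommutativeSemigroupProperties (CommutativeMonoid.commutativeSemigroup Boolₚ.∨-commutativeMonoid) using (interchange)
open GroupProperties ℚₚ.+-0-group using (∙-cancelˡ)
open CommutativeMonoidSolver ℚₚ.+-0-commutativeMonoid using (Expr; var; id; _⊕_; prove)
open Equivalence using (to; from)

-- Every stable set of a join lies on one side, so the maximal stable sets of G₁ + G₂ are
-- those of G₁ and those of G₂: an equistable weighting of the join restricts to weightings
-- of G₁ and G₂ giving all their maximal stable sets weight 1.  If every such weighting
-- gives weight ½ to some nonempty Aᵢ ⊆ V(Gᵢ), then A₁ ∪ A₂ has weight 1 in the join
-- without being stable.
-- For G the complement of the line graph of a suitable graph H, the stars of H are maximal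
-- stable sets of G, and Σ_{v<5} star v − Σ_{v≥5} star v is twice the set A of edges of H
-- inside {0,…,4}; hence 5 = 4 + 2 φ(A) for every such weighting φ.  An explicit weighting
-- shows that G itself is equistable.

Dominating : (G : Graph) → Subset (n G) → Set
Dominating G S = ∀ v → v ∉ S → ∃ λ u → u ∈ S × adj G v u ≡ true

module _ (G : Graph) where

  stable-∪-⁅⁆ : ∀ {S v} → Stable G S → (∀ u → u ∈ S → adj G v u ≡ false) → Stable G (S ∪ ⁅ v ⁆)
  stable-∪-⁅⁆ {S} {v} S-stable v-isolated i j i∈ j∈ with x∈p∪q⁻ S ⁅ v ⁆ i∈ | x∈p∪q⁻ S ⁅ v ⁆ j∈
  ... | inj₁ i∈S | inj₁ j∈S = S-stable i j i∈S j∈S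
  ... | inj₂ i∈v | inj₁ j∈S rewrite x∈⁅y⁆⇒x≡y v i∈v = v-isolated j j∈S
  ... | inj₁ i∈S | inj₂ j∈v rewrite x∈⁅y⁆⇒x≡y v j∈v = trans (Graph.sym G i v) (v-isolated i i∈S)
  ... | inj₂ i∈v | inj₂ j∈v rewrite x∈⁅y⁆⇒x≡y v i∈v | x∈⁅y⁆⇒x≡y v j∈v = irrefl G v

  maximalStable⇒dominating : ∀ {S} → MaximalStable G S → Dominating G S
  maximalStable⇒dominating {S} (S-stable , S-maximal) v v∉S
    with any? (λ u → u ∈? S ×-dec adj G v u Boolₚ.≟ true)
  ... | yes dominated = dominated
  ... | no undominated = contradiction v∈S v∉S
    where
      v-isolated : ∀ u → u ∈ S → adj G v u ≡ false
      v-isolated u u∈S = Boolₚ.¬-not λ adjacent → undominated (u , u∈S , adjacent)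
      v∈S : v ∈ S
      v∈S = S-maximal (S ∪ ⁅ v ⁆) (p⊆p∪q ⁅ v ⁆) (stable-∪-⁅⁆ S-stable v-isolated)
                      (q⊆p∪q S ⁅ v ⁆ (x∈⁅x⁆ v))

  stable∧dominating⇒maximalStable : ∀ {S} → Stable G S → Dominating G S → MaximalStable G S
  stable∧dominating⇒maximalStable {S} S-stable S-dominating = S-stable , S-maximal
    where
      S-maximal : ∀ T → S ⊆ T → Stable G T → T ⊆ S
      S-maximal T S⊆T T-stable {x} x∈T with x ∈? S
      ... | yes x∈S = x∈S
      ... | no x∉S with S-dominating x x∉S
      ...   | u , u∈S , adjacent = contradiction (trans (sym adjacent) (T-stable x u x∈T (S⊆T u∈S))) λ ()

  maximalStable⇔stable×dominating : ∀ S → MaximalStable G S ⇔ (Stable G S × Dominating G S)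
  maximalStable⇔stable×dominating S = mk⇔
    (λ maximal → proj₁ maximal , maximalStable⇒dominating maximal)
    (λ (stable , dominating) → stable∧dominating⇒maximalStable stable dominating)

  maximalStable-nonempty : ∀ {S} → MaximalStable G S → Fin (n G) → Nonempty S
  maximalStable-nonempty {S} maximal v with v ∈? S
  ... | yes v∈S = v , v∈S
  ... | no v∉S = let (u , u∈S , _) = maximalStable⇒dominating maximal v v∉S in u , u∈S

  stable? : ∀ S → Dec (Stable G S)
  stable? S = map′ (λ h i j i∈S j∈S → h i i∈S j j∈S) (λ h i i∈S j j∈S → h i j i∈S j∈S)
    (all? λ i → i ∈? S →-dec all? λ j → j ∈? S →-dec adj G i j Boolₚ.≟ false)

  dominating? : ∀ S → Dec (Dominating G S)
  dominating? S = all? λ v → ¬? (v ∈? S) →-dec any? λ u → u ∈? S ×-dec adj G v u Boolₚ.≟ true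

  maximalStable? : ∀ S → Dec (MaximalStable G S)
  maximalStable? S = map′ (from characterisation) (to characterisation) (stable? S ×-dec dominating? S)
    where characterisation = maximalStable⇔stable×dominating S

_⇔-dec_ : ∀ {a b} {A : Set a} {B : Set b} → Dec A → Dec B → Dec (A ⇔ B)
a? ⇔-dec b? = map′ (λ (f , g) → mk⇔ f g) (λ e → to e , from e) ((a? →-dec b?) ×-dec (b? →-dec a?))

∀-subset? : ∀ {m} {P : Subset m → Set} → (∀ S → Dec (P S)) → Dec (∀ S → P S)
∀-subset? {zero}  P? = map′ (λ { p [] → p }) (λ h → h []) (P? [])
∀-subset? {suc m} P? = map′ (λ { (t , f) (true ∷ S) → t S ; (t , f) (false ∷ S) → f S })
  (λ h → h ∘ (true ∷_) , h ∘ (false ∷_))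
  (∀-subset? (P? ∘ (true ∷_)) ×-dec ∀-subset? (P? ∘ (false ∷_)))

equistableWeighting? : ∀ G (φ : Fin (n G) → ℚ) →
  Dec ((∀ v → 0ℚ ≤ φ v) × (∀ S → MaximalStable G S ⇔ (weight φ S ≡ 1ℚ)))
equistableWeighting? G φ =
  all? (λ v → 0ℚ ℚₚ.≤? φ v) ×-dec ∀-subset? λ S → maximalStable? G S ⇔-dec (weight φ S ℚₚ.≟ 1ℚ)

weight-⊥ : ∀ {m} (φ : Fin m → ℚ) → weight φ ⊥ ≡ 0ℚ
weight-⊥ {zero}  φ = refl
weight-⊥ {suc m} φ = trans (ℚₚ.+-identityˡ _) (weight-⊥ (φ ∘ suc))

weight-++ : ∀ {m n} (φ : Fin (m + n) → ℚ) S T →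
            weight φ (S ++ T) ≡ weight (φ ∘ (_↑ˡ n)) S +ℚ weight (φ ∘ (m ↑ʳ_)) T
weight-++ φ []      T = sym (ℚₚ.+-identityˡ _)
weight-++ {m = suc m} {n} φ (b ∷ S) T =
  trans (cong (φ₀ +ℚ_) (weight-++ (φ ∘ suc) S T))
        (sym (ℚₚ.+-assoc φ₀ (weight (φ ∘ suc ∘ (_↑ˡ n)) S) (weight (φ ∘ suc ∘ (m ↑ʳ_)) T)))
  where φ₀ = if b then φ zero else 0ℚ

MaximalWeightOne : (G : Graph) → (Fin (n G) → ℚ) → Set
MaximalWeightOne G φ = ∀ S → MaximalStable G S → weight φ S ≡ 1ℚ

HalfForced : (G : Graph) → Subset (n G) → Set
HalfForced G A = ∀ φ → MaximalWeightOne G φ → weight φ A ≡ ½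

Σweight : ∀ {m k} → (Fin m → ℚ) → Vec (Subset m) k → ℚ
Σweight φ []       = 0ℚ
Σweight φ (S ∷ Ss) = weight φ S +ℚ Σweight φ Ss

x+x≡1⇒x≡½ : ∀ x → x +ℚ x ≡ 1ℚ → x ≡ ½
x+x≡1⇒x≡½ x x+x≡1 = begin
  x                  ≡⟨ ℚₚ.*-identityˡ x ⟨
  (½ +ℚ ½) *ℚ x      ≡⟨ ℚₚ.*-distribʳ-+ x ½ ½ ⟩
  ½ *ℚ x +ℚ ½ *ℚ x   ≡⟨ ℚₚ.*-distribˡ-+ ½ x x ⟨
  ½ *ℚ (x +ℚ x)      ≡⟨ cong (½ *ℚ_) x+x≡1 ⟩
  ½ *ℚ 1ℚ            ≡⟨⟩
  ½                  ∎
  where open ≡-Reasoning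

module _ {m} (φ : Fin m → ℚ) where
  open ≡-Reasoning

  Σweight-surplus≡1 : ∀ {k} (Ls : Vec (Subset m) (suc k)) (Rs : Vec (Subset m) k) {x} →
    All (λ S → weight φ S ≡ 1ℚ) Ls → All (λ S → weight φ S ≡ 1ℚ) Rs →
    Σweight φ Ls ≡ Σweight φ Rs +ℚ x → x ≡ 1ℚ
  Σweight-surplus≡1 (L ∷ []) [] {x} (L≡1 ∷ []) [] Σ≡Σ+x = begin
    x               ≡⟨ ℚₚ.+-identityˡ x ⟨
    0ℚ +ℚ x         ≡⟨ Σ≡Σ+x ⟨
    weight φ L +ℚ 0ℚ ≡⟨ ℚₚ.+-identityʳ _ ⟩
    weight φ L      ≡⟨ L≡1 ⟩
    1ℚ              ∎
  Σweight-surplus≡1 (L ∷ Ls) (R ∷ Rs) {x} (L≡1 ∷ Ls≡1) (R≡1 ∷ Rs≡1) Σ≡Σ+x =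
    Σweight-surplus≡1 Ls Rs Ls≡1 Rs≡1 (∙-cancelˡ 1ℚ _ _ (begin
      1ℚ +ℚ Σweight φ Ls                   ≡⟨ cong (_+ℚ Σweight φ Ls) L≡1 ⟨
      weight φ L +ℚ Σweight φ Ls           ≡⟨ Σ≡Σ+x ⟩
      weight φ R +ℚ Σweight φ Rs +ℚ x      ≡⟨ ℚₚ.+-assoc (weight φ R) (Σweight φ Rs) x ⟩
      weight φ R +ℚ (Σweight φ Rs +ℚ x)    ≡⟨ cong (_+ℚ (Σweight φ Rs +ℚ x)) R≡1 ⟩
      1ℚ +ℚ (Σweight φ Rs +ℚ x)            ∎))

halfForced-by-identity : ∀ G A {k} (Ls : Vec (Subset (n G)) (suc k)) (Rs : Vec (Subset (n G)) k) →
  All (MaximalStable G) Ls → All (MaximalStable G) Rs →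
  (∀ φ → Σweight φ Ls ≡ Σweight φ Rs +ℚ (weight φ A +ℚ weight φ A)) → HalfForced G A
halfForced-by-identity G A Ls Rs Ls-maximal Rs-maximal identity φ maximal⇒1 =
  x+x≡1⇒x≡½ _ (Σweight-surplus≡1 φ Ls Rs
    (All.map (maximal⇒1 _) Ls-maximal) (All.map (maximal⇒1 _) Rs-maximal) (identity φ))

↑ˡ-∈-++⇔ : ∀ {m n} (S : Subset m) (T : Subset n) a → (a ↑ˡ n) ∈ S ++ T ⇔ a ∈ S
↑ˡ-∈-++⇔ S T a = mk⇔
  (λ a∈ → lookup⇒[]= a S (trans (sym (lookup-++ˡ S T a)) ([]=⇒lookup a∈)))
  (λ a∈ → lookup⇒[]= _ (S ++ T) (trans (lookup-++ˡ S T a) ([]=⇒lookup a∈)))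

↑ʳ-∈-++⇔ : ∀ {m n} (S : Subset m) (T : Subset n) b → (m ↑ʳ b) ∈ S ++ T ⇔ b ∈ T
↑ʳ-∈-++⇔ S T b = mk⇔
  (λ b∈ → lookup⇒[]= b T (trans (sym (lookup-++ʳ S T b)) ([]=⇒lookup b∈)))
  (λ b∈ → lookup⇒[]= _ (S ++ T) (trans (lookup-++ʳ S T b) ([]=⇒lookup b∈)))

module Join (G₁ G₂ : Graph) where

  private
    n₁ = n G₁
    n₂ = n G₂
    J = join G₁ G₂

  data JoinVertex : Fin (n₁ + n₂) → Set where
    left  : ∀ a → JoinVertex (a ↑ˡ n₂)
    right : ∀ b → JoinVertex (n₁ ↑ʳ b)

  joinVertex : ∀ i → JoinVertex i
  joinVertex i with splitAt n₁ i in eq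
  ... | inj₁ a = subst JoinVertex (splitAt⁻¹-↑ˡ eq) (left a)
  ... | inj₂ b = subst JoinVertex (splitAt⁻¹-↑ʳ eq) (right b)

  adj-↑ˡ↑ˡ : ∀ a a′ → adj J (a ↑ˡ n₂) (a′ ↑ˡ n₂) ≡ adj G₁ a a′
  adj-↑ˡ↑ˡ a a′ rewrite splitAt-↑ˡ n₁ a n₂ | splitAt-↑ˡ n₁ a′ n₂ = refl

  adj-↑ʳ↑ʳ : ∀ b b′ → adj J (n₁ ↑ʳ b) (n₁ ↑ʳ b′) ≡ adj G₂ b b′
  adj-↑ʳ↑ʳ b b′ rewrite splitAt-↑ʳ n₁ n₂ b | splitAt-↑ʳ n₁ n₂ b′ = refl

  adj-↑ˡ↑ʳ : ∀ a b → adj J (a ↑ˡ n₂) (n₁ ↑ʳ b) ≡ true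
  adj-↑ˡ↑ʳ a b rewrite splitAt-↑ˡ n₁ a n₂ | splitAt-↑ʳ n₁ n₂ b = refl

  adj-↑ʳ↑ˡ : ∀ b a → adj J (n₁ ↑ʳ b) (a ↑ˡ n₂) ≡ true
  adj-↑ʳ↑ˡ b a rewrite splitAt-↑ʳ n₁ n₂ b | splitAt-↑ˡ n₁ a n₂ = refl

  maximalStable-++⊥ : ∀ {S} → MaximalStable G₁ S → Nonempty S → MaximalStable J (S ++ ⊥)
  maximalStable-++⊥ {S} S-maximal (s , s∈S) = stable∧dominating⇒maximalStable J stable dominating
    where
      stable : Stable J (S ++ ⊥)
      stable i j i∈ j∈ with joinVertex i | joinVertex j
      ... | left a  | left a′ = trans (adj-↑ˡ↑ˡ a a′)
            (proj₁ S-maximal a a′ (to (↑ˡ-∈-++⇔ S ⊥ a) i∈) (to (↑ˡ-∈-++⇔ S ⊥ a′) j∈))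
      ... | right b | _       = contradiction (to (↑ʳ-∈-++⇔ S ⊥ b) i∈) ∉⊥
      ... | left _  | right b = contradiction (to (↑ʳ-∈-++⇔ S ⊥ b) j∈) ∉⊥
      dominating : Dominating J (S ++ ⊥)
      dominating v v∉ with joinVertex v
      ... | right b = s ↑ˡ n₂ , from (↑ˡ-∈-++⇔ S ⊥ s) s∈S , adj-↑ʳ↑ˡ b s
      ... | left a with maximalStable⇒dominating G₁ S-maximal a (v∉ ∘ from (↑ˡ-∈-++⇔ S ⊥ a))
      ...   | u , u∈S , adjacent = u ↑ˡ n₂ , from (↑ˡ-∈-++⇔ S ⊥ u) u∈S , trans (adj-↑ˡ↑ˡ a u) adjacent

  maximalStable-⊥++ : ∀ {T} → MaximalStable G₂ T → Nonempty T → MaximalStable J (⊥ ++ T)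
  maximalStable-⊥++ {T} T-maximal (t , t∈T) = stable∧dominating⇒maximalStable J stable dominating
    where
      stable : Stable J (⊥ ++ T)
      stable i j i∈ j∈ with joinVertex i | joinVertex j
      ... | right b | right b′ = trans (adj-↑ʳ↑ʳ b b′)
            (proj₁ T-maximal b b′ (to (↑ʳ-∈-++⇔ ⊥ T b) i∈) (to (↑ʳ-∈-++⇔ ⊥ T b′) j∈))
      ... | left a  | _        = contradiction (to (↑ˡ-∈-++⇔ ⊥ T a) i∈) ∉⊥
      ... | right _ | left a   = contradiction (to (↑ˡ-∈-++⇔ ⊥ T a) j∈) ∉⊥
      dominating : Dominating J (⊥ ++ T)
      dominating v v∉ with joinVertex v
      ... | left a = n₁ ↑ʳ t , from (↑ʳ-∈-++⇔ ⊥ T t) t∈T , adj-↑ˡ↑ʳ a t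
      ... | right b with maximalStable⇒dominating G₂ T-maximal b (v∉ ∘ from (↑ʳ-∈-++⇔ ⊥ T b))
      ...   | u , u∈T , adjacent = n₁ ↑ʳ u , from (↑ʳ-∈-++⇔ ⊥ T u) u∈T , trans (adj-↑ʳ↑ʳ b u) adjacent

  module _ {ψ : Fin (n₁ + n₂) → ℚ} (ψ-maximal⇒1 : MaximalWeightOne J ψ) where
    open ≡-Reasoning

    private
      ψ₁ = ψ ∘ (_↑ˡ n₂)
      ψ₂ = ψ ∘ (n₁ ↑ʳ_)

    maximalWeightOne-↑ˡ : Fin n₁ → MaximalWeightOne G₁ ψ₁
    maximalWeightOne-↑ˡ v S S-maximal = begin
      weight ψ₁ S                 ≡⟨ ℚₚ.+-identityʳ _ ⟨
      weight ψ₁ S +ℚ 0ℚ           ≡⟨ cong (weight ψ₁ S +ℚ_) (weight-⊥ ψ₂) ⟨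
      weight ψ₁ S +ℚ weight ψ₂ ⊥  ≡⟨ weight-++ ψ S ⊥ ⟨
      weight ψ (S ++ ⊥)           ≡⟨ ψ-maximal⇒1 (S ++ ⊥) S++⊥-maximal ⟩
      1ℚ                          ∎
      where S++⊥-maximal = maximalStable-++⊥ S-maximal (maximalStable-nonempty G₁ S-maximal v)

    maximalWeightOne-↑ʳ : Fin n₂ → MaximalWeightOne G₂ ψ₂
    maximalWeightOne-↑ʳ v T T-maximal = begin
      weight ψ₂ T                 ≡⟨ ℚₚ.+-identityˡ _ ⟨
      0ℚ +ℚ weight ψ₂ T           ≡⟨ cong (_+ℚ weight ψ₂ T) (weight-⊥ ψ₁) ⟨
      weight ψ₁ ⊥ +ℚ weight ψ₂ T  ≡⟨ weight-++ ψ ⊥ T ⟨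
      weight ψ (⊥ ++ T)           ≡⟨ ψ-maximal⇒1 (⊥ ++ T) ⊥++T-maximal ⟩
      1ℚ                          ∎
      where ⊥++T-maximal = maximalStable-⊥++ T-maximal (maximalStable-nonempty G₂ T-maximal v)

  join-¬equistable : ∀ {A₁ A₂} → Nonempty A₁ → Nonempty A₂ → HalfForced G₁ A₁ → HalfForced G₂ A₂ →
                     ¬ Equistable J
  join-¬equistable {A₁} {A₂} (a , a∈A₁) (b , b∈A₂) A₁-half A₂-half (ψ , _ , ψ-equistable) =
    contradiction (trans (sym (adj-↑ˡ↑ʳ a b)) a↑ˡ-b↑ʳ-nonadjacent) λ ()
    where
      open ≡-Reasoning
      ψ-maximal⇒1 : MaximalWeightOne J ψ
      ψ-maximal⇒1 S = to (ψ-equistable S)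

      A₁++A₂-maximal : MaximalStable J (A₁ ++ A₂)
      A₁++A₂-maximal = from (ψ-equistable (A₁ ++ A₂)) (begin
        weight ψ (A₁ ++ A₂)                                    ≡⟨ weight-++ ψ A₁ A₂ ⟩
        weight (ψ ∘ (_↑ˡ n₂)) A₁ +ℚ weight (ψ ∘ (n₁ ↑ʳ_)) A₂  ≡⟨ cong₂ _+ℚ_ A₁-weight A₂-weight ⟩
        ½ +ℚ ½                                                 ≡⟨⟩
        1ℚ                                                     ∎)
        where
          A₁-weight = A₁-half _ (maximalWeightOne-↑ˡ ψ-maximal⇒1 a)
          A₂-weight = A₂-half _ (maximalWeightOne-↑ʳ ψ-maximal⇒1 b)

      a↑ˡ-b↑ʳ-nonadjacent : adj J (a ↑ˡ n₂) (n₁ ↑ʳ b) ≡ false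
      a↑ˡ-b↑ʳ-nonadjacent =
        proj₁ A₁++A₂-maximal _ _ (from (↑ˡ-∈-++⇔ A₁ A₂ a) a∈A₁) (from (↑ʳ-∈-++⇔ A₁ A₂ b) b∈A₂)

≡ᵇ-refl : ∀ m → (m ≡ᵇ m) ≡ true
≡ᵇ-refl zero    = refl
≡ᵇ-refl (suc m) = ≡ᵇ-refl m

≡ᵇ-sym : ∀ m m′ → (m ≡ᵇ m′) ≡ (m′ ≡ᵇ m)
≡ᵇ-sym zero    zero     = refl
≡ᵇ-sym zero    (suc m′) = refl
≡ᵇ-sym (suc m) zero     = refl
≡ᵇ-sym (suc m) (suc m′) = ≡ᵇ-sym m m′

incident : ℕ → ℕ × ℕ → Bool
incident v (a , b) = (v ≡ᵇ a) ∨ (v ≡ᵇ b)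

meet : ℕ × ℕ → ℕ × ℕ → Bool
meet (a , b) e = incident a e ∨ incident b e

meet-refl : ∀ e → meet e e ≡ true
meet-refl (a , b) rewrite ≡ᵇ-refl a = refl

meet-sym : ∀ e f → meet e f ≡ meet f e
meet-sym (a , b) (c , d) = begin
  ((a ≡ᵇ c) ∨ (a ≡ᵇ d)) ∨ ((b ≡ᵇ c) ∨ (b ≡ᵇ d))  ≡⟨ interchange (a ≡ᵇ c) _ _ _ ⟩
  ((a ≡ᵇ c) ∨ (b ≡ᵇ c)) ∨ ((a ≡ᵇ d) ∨ (b ≡ᵇ d))  ≡⟨ cong₂ _∨_ (cong₂ _∨_ (≡ᵇ-sym a c) (≡ᵇ-sym b c))
                                                              (cong₂ _∨_ (≡ᵇ-sym a d) (≡ᵇ-sym b d)) ⟩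
  ((c ≡ᵇ a) ∨ (c ≡ᵇ b)) ∨ ((d ≡ᵇ a) ∨ (d ≡ᵇ b))  ∎
  where open ≡-Reasoning

-- The complement of the line graph of the multigraph with edge list E.
disjointnessGraph : ∀ {m} → Vec (ℕ × ℕ) m → Graph
disjointnessGraph {m} E = record
  { n      = m
  ; adj    = λ i j → not (meet (lookup E i) (lookup E j))
  ; sym    = λ i j → cong not (meet-sym (lookup E i) (lookup E j))
  ; irrefl = λ i → cong not (meet-refl (lookup E i))
  }

-- For concrete S, ⟦ formalWeight S ⟧ (tabulate φ) reduces to weight φ S, so the
-- commutative-monoid solver proves identities between weights.
formalWeight : ∀ {m} → Subset m → Expr m
formalWeight S = Vec.foldr′ (λ i e → (if lookup S i then var i else id) ⊕ e) id (Vec.allFin _)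

Σformal : ∀ {m k} → Vec (Subset m) k → Expr m
Σformal = Vec.foldr′ (λ S e → formalWeight S ⊕ e) id

H : Vec (ℕ × ℕ) 14
H = (2 , 4) ∷ (0 , 1) ∷ (4 , 7) ∷ (1 , 7) ∷ (2 , 8) ∷ (2 , 5) ∷ (3 , 7) ∷
    (4 , 6) ∷ (3 , 6) ∷ (3 , 5) ∷ (0 , 5) ∷ (0 , 6) ∷ (3 , 8) ∷ (1 , 8) ∷ []

G : Graph
G = disjointnessGraph H

star : ℕ → Subset 14
star v = Vec.map (incident v) H

lowStars : Vec (Subset 14) 5
lowStars = Vec.map star (0 ∷ 1 ∷ 2 ∷ 3 ∷ 4 ∷ [])

highStars : Vec (Subset 14) 4
highStars = Vec.map star (5 ∷ 6 ∷ 7 ∷ 8 ∷ [])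

lowEdges : Subset 14
lowEdges = Vec.map (λ (a , b) → (a <ᵇ 5) ∧ (b <ᵇ 5)) H

-- Every edge of H outside lowEdges has exactly one endpoint below 5.
star-identity : ∀ φ →
  Σweight φ lowStars ≡ Σweight φ highStars +ℚ (weight φ lowEdges +ℚ weight φ lowEdges)
star-identity φ = prove 14
  (Σformal lowStars) (Σformal highStars ⊕ (formalWeight lowEdges ⊕ formalWeight lowEdges)) (tabulate φ)

lowEdges-halfForced : HalfForced G lowEdges
lowEdges-halfForced = halfForced-by-identity G lowEdges lowStars highStars
  (toWitness {a? = All.all? (maximalStable? G) lowStars} _)
  (toWitness {a? = All.all? (maximalStable? G) highStars} _)
  star-identity

G-weighting : Fin 14 → ℚ
G-weighting i = + lookup (68 ∷ 22 ∷ 91 ∷ 66 ∷ 49 ∷ 63 ∷ 23 ∷ 21 ∷ 82 ∷ 36 ∷ 81 ∷ 77 ∷ 39 ∷ 92 ∷ []) i / 180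

G-equistable : Equistable G
G-equistable = G-weighting , toWitness {a? = equistableWeighting? G G-weighting} _

corollary2 : Σ Graph λ G₁ → Σ Graph λ G₂ →
               Equistable G₁ × Equistable G₂ × ¬ Equistable (join G₁ G₂)
corollary2 = G , G , G-equistable , G-equistable ,
  Join.join-¬equistable G G {lowEdges} {lowEdges}
    (zero , here) (zero , here) lowEdges-halfForced lowEdges-halfForced
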